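{- Let $G$ be an $(n-3)$-regular graph of order $n\ge 5$ and let $B$ be a Roman bondage set of $G$. Let $x\in V(G)$ and let $y,z$ be the only two vertices (other than $x$) not adjacent to $x$ in $G$. Suppose $E_G(x)\cap B=\{xw\}$ and let $G'=G-B$. Then $|E(G'[\{y,z,w\}])|\le 1$; equivalently, $|E(G[\{y,z,w\}])\cap B|\ge 1$ if $|E(G[\{y,z,w\}])|=2$, and $|E(G[\{y,z,w\}])\cap B|\ge 2$ if $|E(G[\{y,z,w\}])|=3$.
   Context: All graphs are finite, simple and undirected. For a vertex $x$, $E_G(x)$ denotes the set of edges of $G$ incident with $x$; $G[S]$ denotes the subgraph induced by $S$. A Roman dominating function on $G=(V,E)$ is a function $f:V\to\{0,1,2\}$ such that every vertex $u$ with $f(u)=0$ is adjacent to some vertex $v$ with $f(v)=2$; its weight is $\sum_{u\in V}f(u)$, and $\gamma_{\rm R}(G)$ is the minimum weight of a Roman dominating function on $G$. A Roman bondage set of $G$ is a set $B\subseteq E(G)$ with $\gamma_{\rm R}(G-B)>\gamma_{\rm R}(G)$. -}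

module Defs where

open import Data.Nat using (ℕ; zero; suc; _+_; _≤_; _<_)
open import Data.Fin using (Fin)
open import Data.Bool using (Bool; true; false; _∧_; not; if_then_else_)
open import Data.List using (List; map; allFin)
open import Data.Nat.ListAction using (sum)
open import Data.Product using (Σ; _×_; ∃)
open import Relation.Binary.PropositionalEquality using (_≡_)

record Graph (n : ℕ) : Set where
  field
    adj   : Fin n → Fin n → Bool
    sym   : ∀ u v → adj u v ≡ adj v u
    irrefl : ∀ u → adj u u ≡ false
open Graph public

b2n : Bool → ℕ
b2n true  = 1
b2n false = 0

Σv : ∀ {n} → (Fin n → ℕ) → ℕ
Σv {n} f = sum (map f (allFin n))

degree : ∀ {n} → Graph n → Fin n → ℕ
degree G u = Σv (λ v → b2n (adj G u v))

Regular : ∀ {n} → Graph n → ℕ → Set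
Regular G k = ∀ u → degree G u ≡ k

record EdgeSet {n} (G : Graph n) : Set where
  field
    mem  : Fin n → Fin n → Bool
    memSym : ∀ u v → mem u v ≡ mem v u
    sub  : ∀ u v → mem u v ≡ true → adj G u v ≡ true
open EdgeSet public

_─_ : ∀ {n} (G : Graph n) → EdgeSet G → Graph n
G ─ B = record
  { adj = λ u v → adj G u v ∧ not (mem B u v)
  ; sym = λ u v → sym' u v
  ; irrefl = λ u → irr u }
  where
  open import Relation.Binary.PropositionalEquality using (cong₂; cong)
  sym' : ∀ u v → (adj G u v ∧ not (mem B u v)) ≡ (adj G v u ∧ not (mem B v u))
  sym' u v = cong₂ (λ a b → a ∧ not b) (sym G u v) (memSym B u v)
  irr : ∀ u → (adj G u u ∧ not (mem B u u)) ≡ false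
  irr u = cong (λ a → a ∧ not (mem B u u)) (irrefl G u)

data RVal : Set where
  r0 r1 r2 : RVal

rval : RVal → ℕ
rval r0 = 0
rval r1 = 1
rval r2 = 2

IsRDF : ∀ {n} → Graph n → (Fin n → RVal) → Set
IsRDF G f = ∀ u → f u ≡ r0 → Σ _ (λ v → (adj G u v ≡ true) × (f v ≡ r2))

weight : ∀ {n} → (Fin n → RVal) → ℕ
weight f = Σv (λ u → rval (f u))

RomanDomNumber : ∀ {n} → Graph n → ℕ → Set
RomanDomNumber G k =
  Σ _ (λ f → IsRDF G f × (weight f ≡ k)) × (∀ g → IsRDF G g → k ≤ weight g)

RomanBondageSet : ∀ {n} (G : Graph n) → EdgeSet G → Set
RomanBondageSet G B = ∀ k k' → RomanDomNumber G k → RomanDomNumber (G ─ B) k' → k < k'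

edges3 : ∀ {n} → Graph n → Fin n → Fin n → Fin n → ℕ
edges3 H a b c = b2n (adj H a b) + b2n (adj H a c) + b2n (adj H b c)

-- A graph of order n ≥ 4 and maximum degree at most n − 3 has Roman domination
-- number at least 4: a vertex v labelled 2 has at least three non-neighbours
-- (v itself included), so either a second 2 occurs or all of them are labelled
-- at least 1, and v is labelled 2. Hence if G − B still contains two vertices x, t that
-- dominate it, labelling them 2 is a Roman dominating function of weight 4 for
-- both G and G − B, and B is not a Roman bondage set. In G − B the vertex x is
-- adjacent to everything outside {x, y, z, w}; two edges of G − B inside
-- {y, z, w} meet in a vertex t adjacent to the other two, and {x, t} dominates.
module Submission where

open import Defs
open import Data.Nat using (ℕ; zero; suc; _+_; _∸_; _≤_; _<_; z≤n; s≤s)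
open import Data.Nat.Properties
  using (≤-refl; ≤-reflexive; ≤-trans; <-irrefl; n≤1+n; m≤m+n; m≤n+m; +-comm; +-suc;
         +-identityʳ; +-mono-≤; +-monoʳ-≤; +-mono-<-≤; +-mono-≤-<; ∸-monoʳ-≤;
         m+n∸m≡n; m∸[m∸n]≡n; module ≤-Reasoning)
open import Data.Fin using (Fin; zero; suc; _≟_)
open import Data.Fin.Properties using (suc-injective; any?)
open import Data.Bool using (Bool; true; false; _∧_; not)
open import Data.List.Properties using (map-tabulate)
open import Data.Nat.ListAction using (sum)
open import Data.Product using (_×_; _,_; proj₂; map₂)
open import Data.Sum using (_⊎_; inj₁; inj₂)
open import Data.Empty using (⊥; ⊥-elim)
open import Function using (_∘_; id)
open import Relation.Binary.PropositionalEquality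
  using (_≡_; _≢_; refl; cong; cong₂; trans; module ≡-Reasoning)
  renaming (sym to ≡-sym)
open import Relation.Nullary using (¬_; Dec; yes; no; contradiction)
open import Relation.Nullary.Decidable using (_×-dec_; ¬?)

Σv-suc : ∀ {n} (f : Fin (suc n) → ℕ) → Σv f ≡ f zero + Σv (f ∘ suc)
Σv-suc f = cong (λ xs → f zero + sum xs)
  (trans (map-tabulate suc f) (≡-sym (map-tabulate id (f ∘ suc))))

Σv-mono-≤ : ∀ {n} {f g : Fin n → ℕ} → (∀ u → f u ≤ g u) → Σv f ≤ Σv g
Σv-mono-≤ {zero}          f≤g = z≤n
Σv-mono-≤ {suc n} {f} {g} f≤g rewrite Σv-suc f | Σv-suc g =
  +-mono-≤ (f≤g zero) (Σv-mono-≤ (f≤g ∘ suc))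

Σv-mono-< : ∀ {n} {f g : Fin n → ℕ} (a : Fin n) →
            (∀ u → f u ≤ g u) → f a < g a → Σv f < Σv g
Σv-mono-< {suc n} {f} {g} zero    f≤g fa<ga rewrite Σv-suc f | Σv-suc g =
  +-mono-<-≤ fa<ga (Σv-mono-≤ (f≤g ∘ suc))
Σv-mono-< {suc n} {f} {g} (suc a) f≤g fa<ga rewrite Σv-suc f | Σv-suc g =
  +-mono-≤-< (f≤g zero) (Σv-mono-< a (f≤g ∘ suc) fa<ga)

Σv-one : ∀ n → Σv {n} (λ _ → 1) ≡ n
Σv-one zero    = refl
Σv-one (suc n) = trans (Σv-suc {n} (λ _ → 1)) (cong suc (Σv-one n))

Σv-true+Σv-false : ∀ {n} (p : Fin n → Bool) →
                   Σv (b2n ∘ p) + Σv (b2n ∘ not ∘ p) ≡ n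
Σv-true+Σv-false {zero}  p = refl
Σv-true+Σv-false {suc n} p
  rewrite Σv-suc (b2n ∘ p) | Σv-suc (b2n ∘ not ∘ p) with p zero
... | true  = cong suc (Σv-true+Σv-false (p ∘ suc))
... | false = trans (+-suc _ _) (cong suc (Σv-true+Σv-false (p ∘ suc)))

Σv-≥-point : ∀ {n} (f : Fin n → ℕ) a → f a ≤ Σv f
Σv-≥-point f zero    rewrite Σv-suc f = m≤m+n (f zero) _
Σv-≥-point f (suc a) rewrite Σv-suc f = ≤-trans (Σv-≥-point (f ∘ suc) a) (m≤n+m _ (f zero))

Σv-≥-pair : ∀ {n} (f : Fin n → ℕ) {a b} → a ≢ b → f a + f b ≤ Σv f
Σv-≥-pair f {zero}  {zero}  a≢b = ⊥-elim (a≢b refl)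
Σv-≥-pair f {zero}  {suc b} a≢b rewrite Σv-suc f = +-monoʳ-≤ (f zero) (Σv-≥-point (f ∘ suc) b)
Σv-≥-pair f {suc a} {zero}  a≢b rewrite Σv-suc f | +-comm (f (suc a)) (f zero) =
  +-monoʳ-≤ (f zero) (Σv-≥-point (f ∘ suc) a)
Σv-≥-pair f {suc a} {suc b} a≢b rewrite Σv-suc f =
  ≤-trans (Σv-≥-pair (f ∘ suc) (a≢b ∘ cong suc)) (m≤n+m _ (f zero))

Σv-zero : ∀ {n} (f : Fin n → ℕ) → (∀ u → f u ≡ 0) → Σv f ≡ 0
Σv-zero {zero}  f f≡0 = refl
Σv-zero {suc n} f f≡0 rewrite Σv-suc f | f≡0 zero = Σv-zero (f ∘ suc) (f≡0 ∘ suc)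

Σv-supportedAt : ∀ {n} (f : Fin n → ℕ) a → (∀ u → u ≢ a → f u ≡ 0) → Σv f ≡ f a
Σv-supportedAt f zero    off rewrite Σv-suc f =
  trans (cong (f zero +_) (Σv-zero (f ∘ suc) (λ u → off (suc u) λ ()))) (+-identityʳ _)
Σv-supportedAt f (suc a) off rewrite Σv-suc f | off zero (λ ()) =
  Σv-supportedAt (f ∘ suc) a (λ u u≢a → off (suc u) (u≢a ∘ suc-injective))

Σv-supportedAt₂ : ∀ {n} (f : Fin n → ℕ) {a b} → a ≢ b →
                  (∀ u → u ≢ a → u ≢ b → f u ≡ 0) → Σv f ≡ f a + f b
Σv-supportedAt₂ f {zero}  {zero}  a≢b off = ⊥-elim (a≢b refl)
Σv-supportedAt₂ f {zero}  {suc b} a≢b off rewrite Σv-suc f =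
  cong (f zero +_) (Σv-supportedAt (f ∘ suc) b (λ u u≢b → off (suc u) (λ ()) (u≢b ∘ suc-injective)))
Σv-supportedAt₂ f {suc a} {zero}  a≢b off rewrite Σv-suc f =
  trans (cong (f zero +_) (Σv-supportedAt (f ∘ suc) a (λ u u≢a → off (suc u) (u≢a ∘ suc-injective) (λ ()))))
        (+-comm (f zero) (f (suc a)))
Σv-supportedAt₂ f {suc a} {suc b} a≢b off rewrite Σv-suc f | off zero (λ ()) (λ ()) =
  Σv-supportedAt₂ (f ∘ suc) (a≢b ∘ cong suc)
    (λ u u≢a u≢b → off (suc u) (u≢a ∘ suc-injective) (u≢b ∘ suc-injective))

IsRDF-fromDeletion : ∀ {n} {G : Graph n} (B : EdgeSet G) {f : Fin n → RVal} →
                     IsRDF (G ─ B) f → IsRDF G f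
IsRDF-fromDeletion {G = G} B rdf u fu≡r0 with rdf u fu≡r0
... | v , uv∈G─B , fv≡r2 = v , ∧-true-left uv∈G─B , fv≡r2
  where
  ∧-true-left : ∀ {b} → (adj G u v ∧ b) ≡ true → adj G u v ≡ true
  ∧-true-left e with adj G u v
  ... | true  = refl
  ... | false = e

is-r2? : (a : RVal) → Dec (a ≡ r2)
is-r2? r0 = no λ ()
is-r2? r1 = no λ ()
is-r2? r2 = yes refl

weight-≥-order : ∀ {n} (g : Fin n → RVal) → (∀ u → g u ≢ r0) → n ≤ weight g
weight-≥-order {n} g g≢r0 = begin
  n                ≡⟨ Σv-one n ⟨
  Σv {n} (λ _ → 1) ≤⟨ Σv-mono-≤ positive ⟩
  weight g         ∎
  where
  open ≤-Reasoning
  positive : ∀ u → 1 ≤ rval (g u)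
  positive u with g u | g≢r0 u
  ... | r0 | gu≢r0 = ⊥-elim (gu≢r0 refl)
  ... | r1 | _     = ≤-refl
  ... | r2 | _     = s≤s z≤n

weight-≥-two-r2 : ∀ {n} (g : Fin n → RVal) {u v} → u ≢ v → g u ≡ r2 → g v ≡ r2 → 4 ≤ weight g
weight-≥-two-r2 g u≢v gu≡r2 gv≡r2 =
  ≤-trans (≤-reflexive (cong₂ (λ a b → rval a + rval b) (≡-sym gu≡r2) (≡-sym gv≡r2)))
          (Σv-≥-pair (rval ∘ g) u≢v)

nonNeighbours : ∀ {n} → Graph n → Fin n → ℕ
nonNeighbours G v = Σv (λ u → b2n (not (adj G v u)))

nonNeighbours-≥-3 : ∀ {n} (G : Graph n) v → 3 ≤ n → degree G v ≤ n ∸ 3 → 3 ≤ nonNeighbours G v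
nonNeighbours-≥-3 {n} G v 3≤n deg≤ = begin
  3                                           ≡⟨ m∸[m∸n]≡n 3≤n ⟨
  n ∸ (n ∸ 3)                                 ≤⟨ ∸-monoʳ-≤ n deg≤ ⟩
  n ∸ degree G v                              ≡⟨ cong (_∸ degree G v) (Σv-true+Σv-false (adj G v)) ⟨
  degree G v + nonNeighbours G v ∸ degree G v ≡⟨ m+n∸m≡n (degree G v) (nonNeighbours G v) ⟩
  nonNeighbours G v                           ∎
  where open ≤-Reasoning

-- A non-neighbour of v labelled 0 would need a 2-labelled neighbour other than v.
weight->-nonNeighbours : ∀ {n} (G : Graph n) {g v} → IsRDF G g → g v ≡ r2 →
                         (∀ u → u ≢ v → g u ≢ r2) → nonNeighbours G v < weight g
weight->-nonNeighbours G {g} {v} rdf gv≡r2 onlyAtV = Σv-mono-< v below strictAtV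
  where
  below : ∀ u → b2n (not (adj G v u)) ≤ rval (g u)
  below u with adj G v u in vu
  ... | true = z≤n
  ... | false with g u in gu
  ...   | r1 = ≤-refl
  ...   | r2 = s≤s z≤n
  ...   | r0 with rdf u gu
  ...     | w , uw , gw≡r2 with w ≟ v
  ...       | no w≢v   = ⊥-elim (onlyAtV w w≢v gw≡r2)
  ...       | yes refl = contradiction (trans (≡-sym uw) (trans (sym G u v) vu)) λ ()
  strictAtV : b2n (not (adj G v v)) < rval (g v)
  strictAtV rewrite irrefl G v | gv≡r2 = ≤-refl

weight-≥-4 : ∀ {n} (G : Graph n) → 4 ≤ n → (∀ u → degree G u ≤ n ∸ 3) →
             ∀ g → IsRDF G g → 4 ≤ weight g
weight-≥-4 {n} G 4≤n deg≤ g rdf with any? (λ v → is-r2? (g v))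
... | no noR2 = ≤-trans 4≤n (weight-≥-order g λ u gu≡r0 → noR2 (map₂ proj₂ (rdf u gu≡r0)))
... | yes (v , gv≡r2) with any? (λ u → ¬? (u ≟ v) ×-dec is-r2? (g u))
...   | yes (u , u≢v , gu≡r2) = weight-≥-two-r2 g u≢v gu≡r2 gv≡r2
...   | no noOther = ≤-trans (s≤s (nonNeighbours-≥-3 G v (≤-trans (n≤1+n 3) 4≤n) (deg≤ v)))
                             (weight->-nonNeighbours G rdf gv≡r2 λ u u≢v gu≡r2 → noOther (u , u≢v , gu≡r2))

twoAt : ∀ {n} → Fin n → Fin n → Fin n → RVal
twoAt x t u with u ≟ x | u ≟ t
... | yes _ | _     = r2
... | no _  | yes _ = r2
... | no _  | no _  = r0

twoAt-left : ∀ {n} (x t : Fin n) → twoAt x t x ≡ r2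
twoAt-left x t with x ≟ x
... | yes _  = refl
... | no x≢x = ⊥-elim (x≢x refl)

twoAt-right : ∀ {n} (x t : Fin n) → twoAt x t t ≡ r2
twoAt-right x t with t ≟ x | t ≟ t
... | yes _ | _      = refl
... | no _  | yes _  = refl
... | no _  | no t≢t = ⊥-elim (t≢t refl)

twoAt-r0⇒≢ : ∀ {n} {x t u : Fin n} → twoAt x t u ≡ r0 → u ≢ x × u ≢ t
twoAt-r0⇒≢ {x = x} {t} {u} e with u ≟ x | u ≟ t
twoAt-r0⇒≢ () | yes _ | _
twoAt-r0⇒≢ () | no _  | yes _
... | no u≢x | no u≢t = u≢x , u≢t

twoAt-≢⇒r0 : ∀ {n} {x t u : Fin n} → u ≢ x → u ≢ t → twoAt x t u ≡ r0
twoAt-≢⇒r0 {x = x} {t} {u} u≢x u≢t with u ≟ x | u ≟ t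
... | yes u≡x | _       = ⊥-elim (u≢x u≡x)
... | no _    | yes u≡t = ⊥-elim (u≢t u≡t)
... | no _    | no _    = refl

weight-twoAt : ∀ {n} {x t : Fin n} → x ≢ t → weight (twoAt x t) ≡ 4
weight-twoAt {x = x} {t} x≢t = begin
  weight (twoAt x t)                       ≡⟨ Σv-supportedAt₂ (rval ∘ twoAt x t) x≢t off ⟩
  rval (twoAt x t x) + rval (twoAt x t t)  ≡⟨ cong₂ (λ a b → rval a + rval b) (twoAt-left x t) (twoAt-right x t) ⟩
  4                                        ∎
  where
  open ≡-Reasoning
  off : ∀ u → u ≢ x → u ≢ t → rval (twoAt x t u) ≡ 0
  off u u≢x u≢t = cong rval (twoAt-≢⇒r0 u≢x u≢t)

DominatedBy : ∀ {n} → Graph n → Fin n → Fin n → Set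
DominatedBy H x t = ∀ u → u ≢ x → u ≢ t → adj H x u ≡ true ⊎ adj H t u ≡ true

twoAt-IsRDF : ∀ {n} (H : Graph n) {x t} → DominatedBy H x t → IsRDF H (twoAt x t)
twoAt-IsRDF H {x} {t} dom u twoAt≡r0 with twoAt-r0⇒≢ twoAt≡r0
... | u≢x , u≢t with dom u u≢x u≢t
...   | inj₁ xu = x , trans (sym H u x) xu , twoAt-left x t
...   | inj₂ tu = t , trans (sym H u t) tu , twoAt-right x t

DominatedBy-star : ∀ {n} (H : Graph n) {x t s₁ s₂} →
                   (∀ u → u ≢ x → u ≢ t → u ≢ s₁ → u ≢ s₂ → adj H x u ≡ true) →
                   adj H t s₁ ≡ true → adj H t s₂ ≡ true → DominatedBy H x t
DominatedBy-star H {s₁ = s₁} {s₂} xAdj ts₁ ts₂ u u≢x u≢t with u ≟ s₁ | u ≟ s₂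
... | yes refl | _        = inj₂ ts₁
... | no _     | yes refl = inj₂ ts₂
... | no u≢s₁  | no u≢s₂  = inj₁ (xAdj u u≢x u≢t u≢s₁ u≢s₂)

survivingMinimum⇒¬RomanBondageSet : ∀ {n} {G : Graph n} (B : EdgeSet G) (f : Fin n → RVal) →
  IsRDF (G ─ B) f → (∀ g → IsRDF G g → weight f ≤ weight g) → ¬ RomanBondageSet G B
survivingMinimum⇒¬RomanBondageSet {G = G} B f rdf minimal bondage =
  <-irrefl refl (bondage (weight f) (weight f) γ[G] γ[G─B])
  where
  γ[G] : RomanDomNumber G (weight f)
  γ[G] = (f , IsRDF-fromDeletion B rdf , refl) , minimal
  γ[G─B] : RomanDomNumber (G ─ B) (weight f)
  γ[G─B] = (f , rdf , refl) , λ g rdf′ → minimal g (IsRDF-fromDeletion B rdf′)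

dominatingPair⇒¬RomanBondageSet : ∀ {n} (G : Graph n) → 4 ≤ n → (∀ u → degree G u ≤ n ∸ 3) →
  (B : EdgeSet G) {x t : Fin n} → x ≢ t → DominatedBy (G ─ B) x t → ¬ RomanBondageSet G B
dominatingPair⇒¬RomanBondageSet G 4≤n deg≤ B {x} {t} x≢t dom =
  survivingMinimum⇒¬RomanBondageSet B (twoAt x t) (twoAt-IsRDF (G ─ B) dom)
    λ g rdf → ≤-trans (≤-reflexive (weight-twoAt x≢t)) (weight-≥-4 G 4≤n deg≤ g rdf)

edges3-≤-1 : ∀ {n} (H : Graph n) {a b c} →
             (adj H a b ≡ true → adj H a c ≡ true → ⊥) →
             (adj H b a ≡ true → adj H b c ≡ true → ⊥) →
             (adj H c a ≡ true → adj H c b ≡ true → ⊥) →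
             edges3 H a b c ≤ 1
edges3-≤-1 H {a} {b} {c} atA atB atC with adj H a b in ab | adj H a c in ac | adj H b c in bc
... | true  | true  | _     = ⊥-elim (atA refl refl)
... | true  | false | true  = ⊥-elim (atB (trans (sym H b a) ab) refl)
... | false | true  | true  = ⊥-elim (atC (trans (sym H c a) ac) (trans (sym H c b) bc))
... | true  | false | false = ≤-refl
... | false | true  | false = ≤-refl
... | false | false | true  = ≤-refl
... | false | false | false = z≤n

lemma2p8 : (n : ℕ) → 5 ≤ n → (G : Graph n) → Regular G (n ∸ 3)
    → (B : EdgeSet G) → RomanBondageSet G B
    → (x y z w : Fin n)
    → ¬ (y ≡ x) → ¬ (z ≡ x) → ¬ (y ≡ z)
    → adj G x y ≡ false → adj G x z ≡ false
    → (∀ v → ¬ (v ≡ x) → ¬ (v ≡ y) → ¬ (v ≡ z) → adj G x v ≡ true)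
    → adj G x w ≡ true → mem B x w ≡ true
    → (∀ v → mem B x v ≡ true → v ≡ w)
    → edges3 (G ─ B) y z w ≤ 1
lemma2p8 n 5≤n G regular B bondage x y z w y≢x z≢x _ _ _ xAdjG xw∈G _ onlyXw∈B =
  edges3-≤-1 (G ─ B)
    (noCherryAt y z w y≢x λ u u≢x u≢y u≢z u≢w → xAdj u u≢x u≢y u≢z u≢w)
    (noCherryAt z y w z≢x λ u u≢x u≢z u≢y u≢w → xAdj u u≢x u≢y u≢z u≢w)
    (noCherryAt w y z w≢x λ u u≢x u≢w u≢y u≢z → xAdj u u≢x u≢y u≢z u≢w)
  where
  xAdj : ∀ u → u ≢ x → u ≢ y → u ≢ z → u ≢ w → adj (G ─ B) x u ≡ true
  xAdj u u≢x u≢y u≢z u≢w with mem B x u in xu∈B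
  ... | true  = ⊥-elim (u≢w (onlyXw∈B u xu∈B))
  ... | false rewrite xAdjG u u≢x u≢y u≢z = refl
  w≢x : w ≢ x
  w≢x refl = contradiction (trans (≡-sym xw∈G) (irrefl G x)) λ ()
  noCherryAt : ∀ t s₁ s₂ → t ≢ x →
               (∀ u → u ≢ x → u ≢ t → u ≢ s₁ → u ≢ s₂ → adj (G ─ B) x u ≡ true) →
               adj (G ─ B) t s₁ ≡ true → adj (G ─ B) t s₂ ≡ true → ⊥
  noCherryAt t s₁ s₂ t≢x xAdj′ ts₁ ts₂ =
    dominatingPair⇒¬RomanBondageSet G (≤-trans (n≤1+n 4) 5≤n) (≤-reflexive ∘ regular) B
      (t≢x ∘ ≡-sym) (DominatedBy-star (G ─ B) xAdj′ ts₁ ts₂) bondage
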